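{- Let $\mathcal T$ be a planar or toric trinity and $s$ a state. Let $\Delta_1\neq\Delta_2$ be two clockwise (respectively, counter-clockwise) empty black triangles of $s$. Then after changing $\Delta_1$ (performing the clockwise, respectively counter-clockwise, move about $\Delta_1$), the triangle $\Delta_2$ is still an empty black triangle of the same kind, and the state obtained by changing first $\Delta_1$ and then $\Delta_2$ equals the state obtained by changing first $\Delta_2$ and then $\Delta_1$.
   Context: A trinity is a triangulation $\mathcal T$ of a compact connected oriented closed surface $\Sigma$ whose vertices are colored red, green, blue so that the endpoints of every edge have different colors. A triangle is black if its vertices, read clockwise, appear in the cyclic order blue, green, red; otherwise white. A toric trinity is a trinity on the torus; a planar trinity is a trinity on $S^2$ with a chosen white triangle called outer, whose vertices are called roots. A state of a toric trinity is a bijection between white triangles and vertices matching each white triangle with one of its own vertices; for a planar trinity, between non-outer white triangles and non-root vertices. For a black triangle $\Delta$ with vertices $u_1,u_2,u_3$ in clockwise order and $W_i$ the white triangle sharing the edge $u_iu_{i+1}$ with $\Delta$ (indices mod 3): $\Delta$ is a clockwise empty black triangle of $s$ if $s$ matches $W_i$ with $u_{i+1}$ for all $i$, and counter-clockwise empty if $s$ matches $W_i$ with $u_i$ for all $i$. The clockwise move changing a clockwise empty $\Delta$ replaces the pairs $(W_i,u_{i+1})$ by $(W_i,u_i)$ and leaves all other pairs unchanged (so $\Delta$ becomes counter-clockwise empty); the counter-clockwise move is its inverse. -}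

module Defs where

open import Data.Nat using (ℕ; zero; suc; _+_; _*_; _≤_)
open import Data.Fin using (Fin; zero; suc; _≟_)
open import Data.Product using (Σ; ∃; ∃-syntax; _×_; _,_; proj₁; proj₂)
open import Data.Unit using (⊤)
open import Data.Bool using (if_then_else_)
open import Relation.Nullary using (¬_; does)
open import Relation.Binary.PropositionalEquality using (_≡_; _≢_)
open import Relation.Binary.Construct.Closure.ReflexiveTransitive using (Star)

-- Combinatorial model of a triangulated closed oriented surface.
-- Triangles are Fin nt; each triangle t has corners (t , 0), (t , 1),
-- (t , 2) listed in CLOCKWISE order.  Side i of t runs (clockwise) from
-- corner i to corner i+1 (mod 3).  'glue' pairs up sides (a fixed-point
-- free involution); gluing is orientation-compatible: if side i of t is
-- glued to side j of t', then corner i of t is identified with corner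
-- j+1 of t' and corner i+1 of t with corner j of t'.
-- Vertices are exactly the orbits of the resulting rotation of corners
-- around vertices (this is the standard combinatorial-map quotient).

data Color : Set where
  red green blue : Color

next : Fin 3 → Fin 3
next zero = suc zero
next (suc zero) = suc (suc zero)
next (suc (suc zero)) = zero

Corner : ℕ → Set
Corner nt = Fin nt × Fin 3

iter : {A : Set} → (A → A) → ℕ → A → A
iter f zero x = x
iter f (suc k) x = f (iter f k x)

record Trinity (nt nv : ℕ) : Set where
  field
    glue        : Corner nt → Corner nt          -- side (t , i) ↦ the side glued to it
    glue-invol  : ∀ x → glue (glue x) ≡ x
    glue-nofix  : ∀ x → glue x ≢ x
    vert        : Corner nt → Fin nv
    color       : Fin nv → Color
    nonempty    : 1 ≤ nt
  -- rotation of corners around their vertex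
  rot : Corner nt → Corner nt
  rot c = proj₁ (glue c) , next (proj₂ (glue c))
  Adj : Fin nt → Fin nt → Set
  Adj t t' = ∃[ i ] ∃[ j ] glue (t , i) ≡ (t' , j)
  field
    vert-orbit  : ∀ c c' → vert c ≡ vert c' → ∃[ k ] iter rot k c ≡ c'
    orbit-vert  : ∀ c c' (k : ℕ) → iter rot k c ≡ c' → vert c ≡ vert c'
    vert-surj   : ∀ v → ∃[ c ] vert c ≡ v
    connected   : ∀ t t' → Star Adj t t'
    proper      : ∀ t i → color (vert (t , i)) ≢ color (vert (t , next i))

  u : Fin nt → Fin 3 → Fin nv
  u t i = vert (t , i)

  W : Fin nt → Fin 3 → Fin nt
  W t i = proj₁ (glue (t , i))

  Black : Fin nt → Set
  Black t = ∃[ i ] (color (u t i) ≡ blue × color (u t (next i)) ≡ green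
                    × color (u t (next (next i))) ≡ red)

  White : Fin nt → Set
  White t = ¬ Black t

open Trinity public

-- Toric trinity: the (connected, closed, oriented) surface has Euler
-- characteristic V - E + F = nv - 3nt/2 + nt = 0.
-- Planar trinity: Euler characteristic 2, plus a chosen white outer triangle.
data Setting {nt nv : ℕ} (T : Trinity nt nv) : Set where
  toric  : 2 * nv ≡ nt → Setting T
  planar : (o : Fin nt) → White T o → 2 * nv ≡ nt + 4 → Setting T

InDomT : ∀ {nt nv} {T : Trinity nt nv} → Setting T → Fin nt → Set
InDomT {T = T} (toric _)      t = White T t
InDomT {T = T} (planar o _ _) t = White T t × t ≢ o

-- vertices that a state must match (non-root vertices in the planar case)
InDomV : ∀ {nt nv} {T : Trinity nt nv} → Setting T → Fin nv → Set
InDomV (toric _)      v = ⊤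
InDomV {T = T} (planar o _ _) v = ∀ i → vert T (o , i) ≢ v

-- A state: a function on triangles whose values on the relevant white
-- triangles form a bijection onto the relevant vertices, each white
-- triangle being matched with one of its own vertices.  (Values on other
-- triangles are irrelevant.)
IsState : ∀ {nt nv} {T : Trinity nt nv} → Setting T → (Fin nt → Fin nv) → Set
IsState {T = T} S s =
    (∀ t → InDomT S t → ∃[ i ] u T t i ≡ s t)
  × (∀ t → InDomT S t → InDomV S (s t))
  × (∀ t t' → InDomT S t → InDomT S t' → s t ≡ s t' → t ≡ t')
  × (∀ v → InDomV S v → ∃[ t ] (InDomT S t × s t ≡ v))

data Dir : Set where
  cw ccw : Dir

-- "s matches W_i with u_{i+1}" (cw) resp. "with u_i" (ccw)
target : Dir → Fin 3 → Fin 3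
target cw  i = next i
target ccw i = i

-- the vertex W_i gets matched with after the move
newTarget : Dir → Fin 3 → Fin 3
newTarget cw  i = i
newTarget ccw i = next i

Empty : ∀ {nt nv} {T : Trinity nt nv} → Setting T → Dir → (Fin nt → Fin nv) → Fin nt → Set
Empty {T = T} S d s Δ =
  Black T Δ × (∀ i → InDomT S (W T Δ i) × s (W T Δ i) ≡ u T Δ (target d i))

update : ∀ {nt nv} → (Fin nt → Fin nv) → Fin nt → Fin nv → Fin nt → Fin nv
update s t₀ v t = if does (t ≟ t₀) then v else s t

move : ∀ {nt nv} → Trinity nt nv → Dir → (Fin nt → Fin nv) → Fin nt → Fin nt → Fin nv
move T d s Δ =
  update (update (update s (W T Δ zero) (u T Δ (newTarget d zero)))
                 (W T Δ (suc zero)) (u T Δ (newTarget d (suc zero))))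
         (W T Δ (suc (suc zero))) (u T Δ (newTarget d (suc (suc zero))))

-- A move about Δ only redefines the state on the three neighbours
-- W Δ 0, W Δ 1, W Δ 2 of Δ, and the new values do not depend on the old
-- state.  So the theorem reduces to one geometric fact: if Δ₁ ≢ Δ₂ are
-- both empty of the same kind d, their neighbourhoods are disjoint.
-- Indeed, if side i of Δ₁ and side j of Δ₂ are glued to sides a and b of
-- the same triangle w, emptiness forces s w to be the corner
-- newTarget d a of w and also the corner newTarget d b; the three corners
-- of a triangle carry distinct colours, hence a ≡ b, and since gluing is
-- injective (Δ₁ , i) ≡ (Δ₂ , j), contradicting Δ₁ ≢ Δ₂.
module Submission where

open import Defs
open import Data.Nat using (ℕ)
open import Data.Fin using (Fin; zero; suc; _≟_)
open import Data.Fin.Properties using (any?)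
open import Data.Product using (_×_; _,_; proj₁; proj₂; ∃-syntax)
open import Data.Empty using (⊥-elim)
open import Relation.Nullary using (yes; no; ¬_)
open import Relation.Binary.PropositionalEquality
  using (_≡_; _≢_; refl; sym; trans; cong; module ≡-Reasoning)

module _ {nt nv : ℕ} where

  update-other : ∀ (f : Fin nt → Fin nv) t₀ v t → t ≢ t₀ → update f t₀ v t ≡ f t
  update-other f t₀ v t t≢t₀ with t ≟ t₀
  ... | yes t≡t₀ = ⊥-elim (t≢t₀ t≡t₀)
  ... | no _     = refl

  update-agree : ∀ (f g : Fin nt → Fin nv) t₀ v t →
    (t ≢ t₀ → f t ≡ g t) → update f t₀ v t ≡ update g t₀ v t
  update-agree f g t₀ v t agree with t ≟ t₀
  ... | yes _    = refl
  ... | no t≢t₀  = agree t≢t₀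

module _ {nt nv : ℕ} (T : Trinity nt nv) where

  Around : Fin nt → Fin nt → Set
  Around Δ t = ∃[ i ] t ≡ W T Δ i

  after-one-update : Dir → (Fin nt → Fin nv) → Fin nt → Fin nt → Fin nv
  after-one-update d s Δ = update s (W T Δ zero) (u T Δ (newTarget d zero))

  after-two-updates : Dir → (Fin nt → Fin nv) → Fin nt → Fin nt → Fin nv
  after-two-updates d s Δ =
    update (after-one-update d s Δ) (W T Δ (suc zero)) (u T Δ (newTarget d (suc zero)))

  move-outside : ∀ d s Δ t → ¬ Around Δ t → move T d s Δ t ≡ s t
  move-outside d s Δ t out =
    begin
      move T d s Δ t
    ≡⟨ update-other (after-two-updates d s Δ) _ _ t (λ e → out (suc (suc zero) , e)) ⟩
      after-two-updates d s Δ t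
    ≡⟨ update-other (after-one-update d s Δ) _ _ t (λ e → out (suc zero , e)) ⟩
      after-one-update d s Δ t
    ≡⟨ update-other s _ _ t (λ e → out (zero , e)) ⟩
      s t
    ∎
    where open ≡-Reasoning

  move-local : ∀ d s s' Δ t → (¬ Around Δ t → s t ≡ s' t) →
    move T d s Δ t ≡ move T d s' Δ t
  move-local d s s' Δ t agree =
    update-agree (after-two-updates d s Δ) (after-two-updates d s' Δ) _ _ t λ t≢W₂ →
    update-agree (after-one-update d s Δ) (after-one-update d s' Δ) _ _ t λ t≢W₁ →
    update-agree s s' _ _ t λ t≢W₀ →
    agree λ { (zero , e) → t≢W₀ e ; (suc zero , e) → t≢W₁ e ; (suc (suc zero) , e) → t≢W₂ e }

  moves-commute-outside : ∀ d s Δ₁ Δ₂ t → ¬ Around Δ₁ t →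
    move T d (move T d s Δ₁) Δ₂ t ≡ move T d (move T d s Δ₂) Δ₁ t
  moves-commute-outside d s Δ₁ Δ₂ t out =
    trans (move-local d (move T d s Δ₁) s Δ₂ t (λ _ → move-outside d s Δ₁ t out))
          (sym (move-outside d (move T d s Δ₂) Δ₁ t out))

  moves-commute : ∀ d s Δ₁ Δ₂ → (∀ i j → W T Δ₁ i ≢ W T Δ₂ j) →
    ∀ t → move T d (move T d s Δ₁) Δ₂ t ≡ move T d (move T d s Δ₂) Δ₁ t
  moves-commute d s Δ₁ Δ₂ disjoint t with any? (λ i → t ≟ W T Δ₁ i)
  ... | no out = moves-commute-outside d s Δ₁ Δ₂ t out
  ... | yes (i , t≡W₁) = sym (moves-commute-outside d s Δ₂ Δ₁ t
          λ { (j , t≡W₂) → disjoint i j (trans (sym t≡W₁) t≡W₂) })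

prev : Fin 3 → Fin 3
prev zero = suc (suc zero)
prev (suc zero) = zero
prev (suc (suc zero)) = suc zero

prev-next : ∀ a → prev (next a) ≡ a
prev-next zero = refl
prev-next (suc zero) = refl
prev-next (suc (suc zero)) = refl

next-injective : ∀ {a b} → next a ≡ next b → a ≡ b
next-injective {a} {b} e = trans (sym (prev-next a)) (trans (cong prev e) (prev-next b))

newTarget-injective : ∀ d {a b} → newTarget d a ≡ newTarget d b → a ≡ b
newTarget-injective cw  e = e
newTarget-injective ccw e = next-injective e

module _ {nt nv : ℕ} (T : Trinity nt nv) where

  -- The three corners of a triangle are three different vertices, since
  -- any two of them are the endpoints of a side and so differ in colour.
  corner-injective : ∀ w {a b} → u T w a ≡ u T w b → a ≡ b
  corner-injective w {zero}           {zero}           _ = refl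
  corner-injective w {zero}           {suc zero}       e = ⊥-elim (proper T w zero (cong (color T) e))
  corner-injective w {zero}           {suc (suc zero)} e = ⊥-elim (proper T w (suc (suc zero)) (cong (color T) (sym e)))
  corner-injective w {suc zero}       {zero}           e = ⊥-elim (proper T w zero (cong (color T) (sym e)))
  corner-injective w {suc zero}       {suc zero}       _ = refl
  corner-injective w {suc zero}       {suc (suc zero)} e = ⊥-elim (proper T w (suc zero) (cong (color T) e))
  corner-injective w {suc (suc zero)} {zero}           e = ⊥-elim (proper T w (suc (suc zero)) (cong (color T) e))
  corner-injective w {suc (suc zero)} {suc zero}       e = ⊥-elim (proper T w (suc zero) (cong (color T) (sym e)))
  corner-injective w {suc (suc zero)} {suc (suc zero)} _ = refl

  glue-injective : ∀ {x y} → glue T x ≡ glue T y → x ≡ y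
  glue-injective {x} {y} e =
    trans (sym (glue-invol T x)) (trans (cong (glue T) e) (glue-invol T y))

  -- Across a glued side, the start of side i of t is the end of side a
  -- of w (one rotation step around the shared vertex).
  vert-across : ∀ t i w a → glue T (t , i) ≡ (w , a) → u T t i ≡ u T w (next a)
  vert-across t i w a g =
    trans (orbit-vert T (t , i) (rot T (t , i)) 1 refl)
          (cong (λ c → vert T (proj₁ c , next (proj₂ c))) g)

  vert-across′ : ∀ t i w a → glue T (t , i) ≡ (w , a) → u T t (next i) ≡ u T w a
  vert-across′ t i w a g =
    sym (vert-across w a t i (trans (cong (glue T) (sym g)) (glue-invol T (t , i))))

  target-across : ∀ d Δ i w a → glue T (Δ , i) ≡ (w , a) →
    u T Δ (target d i) ≡ u T w (newTarget d a)
  target-across cw  Δ i w a g = vert-across′ Δ i w a g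
  target-across ccw Δ i w a g = vert-across Δ i w a g

  neighbours-disjoint : ∀ d (s : Fin nt → Fin nv) Δ₁ Δ₂ → Δ₁ ≢ Δ₂ → ∀ i j →
    s (W T Δ₁ i) ≡ u T Δ₁ (target d i) → s (W T Δ₂ j) ≡ u T Δ₂ (target d j) →
    W T Δ₁ i ≢ W T Δ₂ j
  neighbours-disjoint d s Δ₁ Δ₂ Δ₁≢Δ₂ i j e₁ e₂ same
    with glue T (Δ₁ , i) in g₁ | glue T (Δ₂ , j) in g₂ | same
  ... | (w , a) | (.w , b) | refl = Δ₁≢Δ₂ (cong proj₁ (glue-injective (trans g₁ (sym g₂′))))
    where
      a≡b : a ≡ b
      a≡b = newTarget-injective d (corner-injective w
              (trans (sym (target-across d Δ₁ i w a g₁))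
              (trans (sym e₁) (trans e₂ (target-across d Δ₂ j w b g₂)))))
      g₂′ : glue T (Δ₂ , j) ≡ (w , a)
      g₂′ = trans g₂ (cong (w ,_) (sym a≡b))

lemma2p6 : ∀ {nt nv} (T : Trinity nt nv) (S : Setting T) (s : Fin nt → Fin nv) →
    IsState S s → (d : Dir) (Δ₁ Δ₂ : Fin nt) → Δ₁ ≢ Δ₂ →
    Empty S d s Δ₁ → Empty S d s Δ₂ →
    Empty S d (move T d s Δ₁) Δ₂
      × (∀ t → InDomT S t → move T d (move T d s Δ₁) Δ₂ t ≡ move T d (move T d s Δ₂) Δ₁ t)
lemma2p6 T S s _ d Δ₁ Δ₂ Δ₁≢Δ₂ (_ , empty₁) (black₂ , empty₂) =
  (black₂ , still-empty) , (λ t _ → moves-commute T d s Δ₁ Δ₂ disjoint t)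
  where
    disjoint : ∀ i j → W T Δ₁ i ≢ W T Δ₂ j
    disjoint i j = neighbours-disjoint T d s Δ₁ Δ₂ Δ₁≢Δ₂ i j
                     (proj₂ (empty₁ i)) (proj₂ (empty₂ j))
    still-empty : ∀ j → InDomT S (W T Δ₂ j) × move T d s Δ₁ (W T Δ₂ j) ≡ u T Δ₂ (target d j)
    still-empty j = proj₁ (empty₂ j)
      , trans (move-outside T d s Δ₁ (W T Δ₂ j) (λ { (i , e) → disjoint i j (sym e) }))
              (proj₂ (empty₂ j))
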